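{- For every integer $n\geq 3$, the accordion graph $A[n,1]$ (the antiprism $A_n$) has the PMH-property.
   Context: For integers $n\geq 3$ and $0<k\leq n/2$, the accordion graph $A[n,k]$ is the graph with vertex set $\{u_1,\dots,u_n,v_1,\dots,v_n\}$ and edge set $\{u_iu_{i+1}, v_iv_{i+1}, u_iv_i, u_iv_{i+k} : i\in\{1,\dots,n\}\}$, indices taken modulo $n$ with residues in $\{1,\dots,n\}$. The antiprism $A_n$ is $A[n,1]$. A graph $G$ with an even number of vertices has the PMH-property (Perfect-Matching-Hamiltonian property) if for every perfect matching $M$ of $G$ there is a perfect matching $N$ of $G$ such that $M\cup N$ is the edge set of a Hamiltonian cycle of $G$. -}

module Defs where

open import Level using (0ℓ)
open import Data.Nat using (ℕ; suc; _+_; _≤_; NonZero)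
open import Data.Nat.DivMod using (_%_)
open import Data.Fin using (Fin; toℕ)
open import Data.Product using (Σ; ∃; _×_; _,_)
open import Data.Sum using (_⊎_)
open import Function.Bundles using (_⤖_; Bijection)
open import Relation.Binary.PropositionalEquality using (_≡_)

record Graph : Set₁ where
  field
    V : Set
    E : V → V → Set

EdgeSet : Graph → Set₁
EdgeSet G = Graph.V G → Graph.V G → Set

record PerfectMatching (G : Graph) : Set₁ where
  open Graph G
  field
    M        : V → V → Set
    M-sym    : ∀ x y → M x y → M y x
    M-edges  : ∀ x y → M x y → E x y
    partner  : V → V
    M-cover  : ∀ x → M x (partner x)
    M-unique : ∀ x y → M x y → y ≡ partner x

_∪E_ : {G : Graph} → EdgeSet G → EdgeSet G → EdgeSet G
(A ∪E B) x y = A x y ⊎ B x y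

-- H is the edge set of a Hamiltonian cycle of G: there is a cyclic
-- enumeration c : Fin (suc m) ⤖ V of all vertices (length ≥ 3), all of
-- whose consecutive pairs are edges of G, and H consists exactly of the
-- (unordered) consecutive pairs {c i, c (i+1 mod (suc m))}.
IsHamCycleEdgeSet : (G : Graph) → EdgeSet G → Set
IsHamCycleEdgeSet G H =
  Σ ℕ λ m → 3 ≤ suc m × Σ (Fin (suc m) ⤖ Graph.V G) λ bij →
    let c = Bijection.to bij
        Cons : Graph.V G → Graph.V G → Set
        Cons x y = Σ (Fin (suc m)) λ i → Σ (Fin (suc m)) λ j →
                     ((toℕ i + 1) % suc m ≡ toℕ j) × c i ≡ x × c j ≡ y
    in (∀ i j → (toℕ i + 1) % suc m ≡ toℕ j → Graph.E G (c i) (c j))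
     × (∀ x y → H x y → Cons x y ⊎ Cons y x)
     × (∀ x y → Cons x y → H x y)
     × (∀ x y → Cons x y → H y x)

PMH : Graph → Set₁
PMH G = (M : PerfectMatching G) →
  Σ (PerfectMatching G) λ N →
    IsHamCycleEdgeSet G (_∪E_ {G} (PerfectMatching.M M) (PerfectMatching.M N))

-- Accordion graph A[n,k]; vertices u i, v i for i ∈ Fin n
-- (index i here corresponds to u_{i+1} in the paper; indices mod n).

data AccV (n : ℕ) : Set where
  u v : Fin n → AccV n

module _ (n : ℕ) .{{_ : NonZero n}} where
  Shift : ℕ → Fin n → Fin n → Set
  Shift s i j = (toℕ i + s) % n ≡ toℕ j

  AccE : ℕ → AccV n → AccV n → Set
  AccE k (u i) (u j) = Shift 1 i j ⊎ Shift 1 j i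
  AccE k (v i) (v j) = Shift 1 i j ⊎ Shift 1 j i
  AccE k (u i) (v j) = i ≡ j ⊎ Shift k i j
  AccE k (v j) (u i) = i ≡ j ⊎ Shift k i j

  Accordion : ℕ → Graph
  Accordion k = record { V = AccV n ; E = AccE k }

Antiprism : (n : ℕ) .{{_ : NonZero n}} → Graph
Antiprism n = Accordion n 1

module Submission where

-- Along the zigzag Hamiltonian cycle v₀ u₀ v₁ u₁ … the antiprism is the graph in which each
-- vertex is adjacent to the vertices at cyclic distance 1 and 2, so every edge of a perfect
-- matching M has length 1 or 2.  An edge {y, y+2} of M forces {y-1, y+1} or {y+1, y+3} into M,
-- and swapping the two middle vertices of every such crossing pair yields a Hamiltonian cycle
-- that still uses only edges of length at most 2 and now contains every edge of M.  The other
-- cycle edges then form a perfect matching N with M ∪ N the cycle.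

open import Data.Empty using (⊥-elim)
open import Data.Fin using (Fin; toℕ; fromℕ<; zero; suc; combine; remQuot)
open import Data.Fin.Properties
  using (toℕ-injective; toℕ<n; toℕ-fromℕ<; toℕ-combine; remQuot-combine; combine-remQuot)
import Data.Fin.Properties as Fin
open import Data.Nat using (ℕ; zero; suc; _+_; _*_; _∸_; _≤_; _<_; s≤s; z≤n; NonZero; _<?_)
open import Data.Nat.DivMod
  using (_%_; %-distribˡ-+; m%n%n≡m%n; m<n⇒m%n≡m; m≤n⇒[n∸m]%m≡n%m; m%n<n; [m+n]%n≡m%n; m%n*o≡m*o%[n*o])
open import Data.Nat.Properties
  using (+-assoc; +-comm; +-identityʳ; +-cancelˡ-≡; +-cancelʳ-<; +-mono-<; m∸n+n≡m; <⇒≢; ≮⇒≥;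
         ≤-trans; n≤1+n; *-comm; *-monoʳ-≤)
open import Data.Nat.Tactic.RingSolver using (solve-∀)
open import Data.Product using (Σ; _×_; _,_; uncurry)
open import Data.Sum using (_⊎_; inj₁; inj₂)
import Data.Sum as Sum
open import Function.Base using (_∘_)
open import Function.Bundles using (mk↔ₛ′)
open import Function.Properties.Inverse using (↔⇒⤖)
open import Relation.Binary using (DecidableEquality)
open import Relation.Binary.PropositionalEquality
open import Relation.Nullary using (¬_; Dec; yes; no)
open import Relation.Nullary.Decidable using (_×-dec_)
open import Defs

iterate : {A : Set} → (A → A) → ℕ → A → A
iterate f zero    x = x
iterate f (suc k) x = f (iterate f k x)

[m%n+o]%n≡[m+o]%n : ∀ m o n .{{_ : NonZero n}} → (m % n + o) % n ≡ (m + o) % n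
[m%n+o]%n≡[m+o]%n m o n = begin
  (m % n + o) % n           ≡⟨ %-distribˡ-+ (m % n) o n ⟩
  (m % n % n + o % n) % n   ≡⟨ cong (λ t → (t + o % n) % n) (m%n%n≡m%n m n) ⟩
  (m % n + o % n) % n       ≡⟨ %-distribˡ-+ m o n ⟨
  (m + o) % n               ∎
  where open ≡-Reasoning

[m+o]%n≡m⇒o≡0 : ∀ m o n .{{_ : NonZero n}} → m < n → o < n → (m + o) % n ≡ m → o ≡ 0
[m+o]%n≡m⇒o≡0 m o n m<n o<n eq with m + o <? n
... | yes m+o<n = +-cancelˡ-≡ m o 0 (trans (sym (m<n⇒m%n≡m m+o<n)) (trans eq (sym (+-identityʳ m))))
... | no m+o≮n = ⊥-elim (<⇒≢ o<n (+-cancelˡ-≡ m o n (begin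
      m + o           ≡⟨ m∸n+n≡m n≤m+o ⟨
      m + o ∸ n + n   ≡⟨ cong (_+ n) wrapped ⟩
      m + n           ∎)))
  where
  open ≡-Reasoning
  n≤m+o : n ≤ m + o
  n≤m+o = ≮⇒≥ m+o≮n
  -- m + o < 2n, so reducing it mod n subtracts n exactly once
  wrapped : m + o ∸ n ≡ m
  wrapped = trans (sym (m<n⇒m%n≡m (+-cancelʳ-< n (m + o ∸ n) n
              (subst (_< n + n) (sym (m∸n+n≡m n≤m+o)) (+-mono-< m<n o<n)))))
              (trans (m≤n⇒[n∸m]%m≡n%m n≤m+o) eq)

module _ {m : ℕ} where

  sucMod predMod : Fin (suc m) → Fin (suc m)
  sucMod  i = fromℕ< (m%n<n (toℕ i + 1) (suc m))
  predMod i = fromℕ< (m%n<n (toℕ i + m) (suc m))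

  toℕ-sucMod : ∀ i → toℕ (sucMod i) ≡ (toℕ i + 1) % suc m
  toℕ-sucMod i = toℕ-fromℕ< (m%n<n (toℕ i + 1) (suc m))

  toℕ-predMod : ∀ i → toℕ (predMod i) ≡ (toℕ i + m) % suc m
  toℕ-predMod i = toℕ-fromℕ< (m%n<n (toℕ i + m) (suc m))

  private
    [i+1+m]%[1+m]≡i : ∀ (i : Fin (suc m)) → (toℕ i + suc m) % suc m ≡ toℕ i
    [i+1+m]%[1+m]≡i i = trans ([m+n]%n≡m%n (toℕ i) (suc m)) (m<n⇒m%n≡m (toℕ<n i))

  sucMod-predMod : ∀ i → sucMod (predMod i) ≡ i
  sucMod-predMod i = toℕ-injective (begin
    toℕ (sucMod (predMod i))          ≡⟨ toℕ-sucMod (predMod i) ⟩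
    (toℕ (predMod i) + 1) % suc m     ≡⟨ cong (λ t → (t + 1) % suc m) (toℕ-predMod i) ⟩
    ((toℕ i + m) % suc m + 1) % suc m ≡⟨ [m%n+o]%n≡[m+o]%n (toℕ i + m) 1 (suc m) ⟩
    (toℕ i + m + 1) % suc m           ≡⟨ cong (_% suc m) (trans (+-assoc (toℕ i) m 1) (cong (toℕ i +_) (+-comm m 1))) ⟩
    (toℕ i + suc m) % suc m           ≡⟨ [i+1+m]%[1+m]≡i i ⟩
    toℕ i                            ∎)
    where open ≡-Reasoning

  predMod-sucMod : ∀ i → predMod (sucMod i) ≡ i
  predMod-sucMod i = toℕ-injective (begin
    toℕ (predMod (sucMod i))          ≡⟨ toℕ-predMod (sucMod i) ⟩
    (toℕ (sucMod i) + m) % suc m      ≡⟨ cong (λ t → (t + m) % suc m) (toℕ-sucMod i) ⟩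
    ((toℕ i + 1) % suc m + m) % suc m ≡⟨ [m%n+o]%n≡[m+o]%n (toℕ i + 1) m (suc m) ⟩
    (toℕ i + 1 + m) % suc m           ≡⟨ cong (_% suc m) (+-assoc (toℕ i) 1 m) ⟩
    (toℕ i + suc m) % suc m           ≡⟨ [i+1+m]%[1+m]≡i i ⟩
    toℕ i                            ∎)
    where open ≡-Reasoning

  toℕ-iterate-sucMod : ∀ k i → toℕ (iterate sucMod k i) ≡ (toℕ i + k) % suc m
  toℕ-iterate-sucMod zero i =
    sym (trans (cong (_% suc m) (+-identityʳ (toℕ i))) (m<n⇒m%n≡m (toℕ<n i)))
  toℕ-iterate-sucMod (suc k) i = begin
    toℕ (sucMod (iterate sucMod k i))      ≡⟨ toℕ-sucMod (iterate sucMod k i) ⟩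
    (toℕ (iterate sucMod k i) + 1) % suc m ≡⟨ cong (λ t → (t + 1) % suc m) (toℕ-iterate-sucMod k i) ⟩
    ((toℕ i + k) % suc m + 1) % suc m      ≡⟨ [m%n+o]%n≡[m+o]%n (toℕ i + k) 1 (suc m) ⟩
    (toℕ i + k + 1) % suc m                ≡⟨ cong (_% suc m) (trans (+-assoc (toℕ i) k 1) (cong (toℕ i +_) (+-comm k 1))) ⟩
    (toℕ i + suc k) % suc m                        ∎
    where open ≡-Reasoning

  iterate-sucMod-≢ : ∀ {k} → 0 < k → k < suc m → ∀ i → iterate sucMod k i ≢ i
  iterate-sucMod-≢ {k} 0<k k<1+m i eq = <⇒≢ 0<k (sym
    ([m+o]%n≡m⇒o≡0 (toℕ i) k (suc m) (toℕ<n i) k<1+m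
      (trans (sym (toℕ-iterate-sucMod k i)) (cong toℕ eq))))

record CyclicOrder (V : Set) (m : ℕ) : Set where
  field
    enumerate        : Fin (suc m) → V
    index            : V → Fin (suc m)
    enumerate-index  : ∀ x → enumerate (index x) ≡ x
    index-enumerate  : ∀ i → index (enumerate i) ≡ i
    next             : V → V
    enumerate-sucMod : ∀ i → enumerate (sucMod i) ≡ next (enumerate i)

  prev : V → V
  prev x = enumerate (predMod (index x))

  index-next : ∀ x → index (next x) ≡ sucMod (index x)
  index-next x = begin
    index (next x)                       ≡⟨ cong (index ∘ next) (enumerate-index x) ⟨
    index (next (enumerate (index x)))   ≡⟨ cong index (enumerate-sucMod (index x)) ⟨
    index (enumerate (sucMod (index x))) ≡⟨ index-enumerate (sucMod (index x)) ⟩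
    sucMod (index x)                        ∎
    where open ≡-Reasoning

  next-prev : ∀ x → next (prev x) ≡ x
  next-prev x = begin
    next (enumerate (predMod (index x)))   ≡⟨ enumerate-sucMod (predMod (index x)) ⟨
    enumerate (sucMod (predMod (index x))) ≡⟨ cong enumerate (sucMod-predMod (index x)) ⟩
    enumerate (index x)                    ≡⟨ enumerate-index x ⟩
    x                                        ∎
    where open ≡-Reasoning

  prev-next : ∀ x → prev (next x) ≡ x
  prev-next x = begin
    enumerate (predMod (index (next x)))   ≡⟨ cong (enumerate ∘ predMod) (index-next x) ⟩
    enumerate (predMod (sucMod (index x))) ≡⟨ cong enumerate (predMod-sucMod (index x)) ⟩
    enumerate (index x)                    ≡⟨ enumerate-index x ⟩
    x                                        ∎
    where open ≡-Reasoning

  next-injective : ∀ {x y} → next x ≡ next y → x ≡ y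
  next-injective {x} {y} eq = trans (sym (prev-next x)) (trans (cong prev eq) (prev-next y))

  prev-unique : ∀ {x y} → next y ≡ x → y ≡ prev x
  prev-unique {x} {y} eq = next-injective (trans eq (sym (next-prev x)))

  enumerate-iterate-sucMod : ∀ k i → enumerate (iterate sucMod k i) ≡ iterate next k (enumerate i)
  enumerate-iterate-sucMod zero    i = refl
  enumerate-iterate-sucMod (suc k) i =
    trans (enumerate-sucMod (iterate sucMod k i)) (cong next (enumerate-iterate-sucMod k i))

  iterate-next-≢ : ∀ {k} → 0 < k → k < suc m → ∀ x → iterate next k x ≢ x
  iterate-next-≢ {k} 0<k k<1+m x eq = iterate-sucMod-≢ 0<k k<1+m (index x) (begin
    iterate sucMod k (index x)                     ≡⟨ index-enumerate _ ⟨
    index (enumerate (iterate sucMod k (index x))) ≡⟨ cong index (enumerate-iterate-sucMod k (index x)) ⟩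
    index (iterate next k (enumerate (index x)))   ≡⟨ cong (index ∘ iterate next k) (enumerate-index x) ⟩
    index (iterate next k x)                       ≡⟨ cong index eq ⟩
    index x                                           ∎)
    where open ≡-Reasoning

  Near : V → V → Set
  Near x y = y ≡ next x ⊎ x ≡ next y ⊎ y ≡ next (next x) ⊎ x ≡ next (next y)

conjugate : ∀ {V m} (τ : V → V) → (∀ x → τ (τ x) ≡ x) → CyclicOrder V m → CyclicOrder V m
conjugate τ τ-involutive C = record
  { enumerate        = τ ∘ enumerate
  ; index            = index ∘ τ
  ; enumerate-index  = λ x → trans (cong τ (enumerate-index (τ x))) (τ-involutive x)
  ; index-enumerate  = λ i → trans (cong index (τ-involutive (enumerate i))) (index-enumerate i)
  ; next             = τ ∘ next ∘ τ
  ; enumerate-sucMod = λ i → cong τ (trans (enumerate-sucMod i) (cong next (sym (τ-involutive (enumerate i)))))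
  }
  where open CyclicOrder C

partner-involutive : ∀ {G} (M : PerfectMatching G) x →
  PerfectMatching.partner M (PerfectMatching.partner M x) ≡ x
partner-involutive M x = sym (M-unique (partner x) x (M-sym x (partner x) (M-cover x)))
  where open PerfectMatching M

module _ (G : Graph) {m : ℕ} (C : CyclicOrder (Graph.V G) m) where
  open Graph G
  open CyclicOrder C

  hamiltonian-edge-set : 3 ≤ suc m → (∀ x → E x (next x)) → (H : EdgeSet G) →
    (∀ x y → H x y → y ≡ next x ⊎ x ≡ next y) →
    (∀ x → H x (next x)) → (∀ x → H (next x) x) →
    IsHamCycleEdgeSet G H
  hamiltonian-edge-set 3≤1+m next-edge H H⇒adjacent H-next H-prev =
    m , 3≤1+m , ↔⇒⤖ (mk↔ₛ′ enumerate index enumerate-index index-enumerate) ,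
    (λ i j e → subst (E (enumerate i)) (sym (consecutive⇒next e)) (next-edge (enumerate i))) ,
    (λ x y h → Sum.map (next⇒consecutive x y) (next⇒consecutive y x) (H⇒adjacent x y h)) ,
    (λ { x y (i , j , e , refl , refl) → subst (H x) (sym (consecutive⇒next e)) (H-next x) }) ,
    (λ { x y (i , j , e , refl , refl) → subst (λ z → H z x) (sym (consecutive⇒next e)) (H-prev x) })
    where
    consecutive⇒next : ∀ {i j} → (toℕ i + 1) % suc m ≡ toℕ j → enumerate j ≡ next (enumerate i)
    consecutive⇒next {i} e =
      trans (cong enumerate (toℕ-injective (trans (sym e) (sym (toℕ-sucMod i))))) (enumerate-sucMod i)
    next⇒consecutive : ∀ x y → y ≡ next x → Σ (Fin (suc m)) λ i → Σ (Fin (suc m)) λ j →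
      ((toℕ i + 1) % suc m ≡ toℕ j) × enumerate i ≡ x × enumerate j ≡ y
    next⇒consecutive x _ refl =
      index x , sucMod (index x) , sym (toℕ-sucMod (index x)) , enumerate-index x ,
      trans (enumerate-sucMod (index x)) (cong next (enumerate-index x))

  module _ (matching : PerfectMatching G) (3≤1+m : 3 ≤ suc m)
           (next-edge : ∀ x → E x (next x)) (prev-edge : ∀ x → E (next x) x)
           (partner-adjacent : ∀ x → PerfectMatching.partner matching x ≡ next x
                                    ⊎ next (PerfectMatching.partner matching x) ≡ x) where
    open PerfectMatching matching renaming (M to Matched)

    private
      next²≢ : ∀ x → next (next x) ≢ x
      next²≢ = iterate-next-≢ {2} (s≤s z≤n) 3≤1+m

    copartner : V → V
    copartner x with partner-adjacent x
    ... | inj₁ _ = prev x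
    ... | inj₂ _ = next x

    copartner-cases : ∀ x → (partner x ≡ next x × copartner x ≡ prev x) ⊎ (next (partner x) ≡ x × copartner x ≡ next x)
    copartner-cases x with partner-adjacent x
    ... | inj₁ e = inj₁ (e , refl)
    ... | inj₂ e = inj₂ (e , refl)

    partner-swap : ∀ {x y} → partner x ≡ y → partner y ≡ x
    partner-swap {x} refl = partner-involutive matching x

    copartner-prev : ∀ {x} → partner x ≡ next x → copartner (prev x) ≡ x
    copartner-prev {x} p≡next with copartner-cases (prev x)
    ... | inj₁ (q≡next , _) = ⊥-elim (next²≢ x (begin
          next (next x)       ≡⟨ cong next (trans (sym p≡next) (partner-swap (trans q≡next (next-prev x)))) ⟩
          next (prev x)       ≡⟨ next-prev x ⟩
          x                   ∎))
      where open ≡-Reasoning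
    ... | inj₂ (_ , o≡next) = trans o≡next (next-prev x)

    copartner-next : ∀ {x} → next (partner x) ≡ x → copartner (next x) ≡ x
    copartner-next {x} next-p≡ with copartner-cases (next x)
    ... | inj₁ (_ , o≡prev) = trans o≡prev (prev-next x)
    ... | inj₂ (next-q≡ , _) = ⊥-elim (next²≢ x (begin
          next (next x)       ≡⟨ cong next (partner-swap (next-injective next-q≡)) ⟨
          next (partner x)    ≡⟨ next-p≡ ⟩
          x                   ∎))
      where open ≡-Reasoning

    copartner-involutive : ∀ x → copartner (copartner x) ≡ x
    copartner-involutive x with copartner-cases x
    ... | inj₁ (p≡next , o≡prev) = trans (cong copartner o≡prev) (copartner-prev p≡next)
    ... | inj₂ (next-p≡ , o≡next) = trans (cong copartner o≡next) (copartner-next next-p≡)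

    complement : PerfectMatching G
    complement = record
      { M        = λ x y → y ≡ copartner x
      ; M-sym    = λ x y y≡ → sym (trans (cong copartner y≡) (copartner-involutive x))
      ; M-edges  = λ x y y≡ → subst (E x) (sym y≡) (copartner-edge x)
      ; partner  = copartner
      ; M-cover  = λ _ → refl
      ; M-unique = λ _ _ y≡ → y≡
      }
      where
      copartner-edge : ∀ x → E x (copartner x)
      copartner-edge x with copartner-cases x
      ... | inj₁ (_ , o≡prev) = subst₂ E (next-prev x) (sym o≡prev) (prev-edge (prev x))
      ... | inj₂ (_ , o≡next) = subst (E x) (sym o≡next) (next-edge x)

    complement-hamiltonian : IsHamCycleEdgeSet G (_∪E_ {G} Matched (PerfectMatching.M complement))
    complement-hamiltonian = hamiltonian-edge-set 3≤1+m next-edge _ adjacent H-next H-prev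
      where
      adjacent : ∀ x y → Matched x y ⊎ y ≡ copartner x → y ≡ next x ⊎ x ≡ next y
      adjacent x y (inj₁ xMy) with partner-adjacent x
      ... | inj₁ p≡next = inj₁ (trans (M-unique x y xMy) p≡next)
      ... | inj₂ next-p≡ = inj₂ (sym (trans (cong next (M-unique x y xMy)) next-p≡))
      adjacent x y (inj₂ y≡) with copartner-cases x
      ... | inj₁ (_ , o≡prev) = inj₂ (sym (trans (cong next (trans y≡ o≡prev)) (next-prev x)))
      ... | inj₂ (_ , o≡next) = inj₁ (trans y≡ o≡next)

      H-next : ∀ x → Matched x (next x) ⊎ next x ≡ copartner x
      H-next x with copartner-cases x
      ... | inj₁ (p≡next , _) = inj₁ (subst (Matched x) p≡next (M-cover x))
      ... | inj₂ (_ , o≡next) = inj₂ (sym o≡next)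

      H-prev : ∀ x → Matched (next x) x ⊎ x ≡ copartner (next x)
      H-prev x with copartner-cases (next x)
      ... | inj₁ (_ , o≡prev) = inj₂ (sym (trans o≡prev (prev-next x)))
      ... | inj₂ (next-p≡ , _) = inj₁ (subst (Matched (next x)) (next-injective next-p≡) (M-cover (next x)))

    matching-on-cycle-extends :
      Σ (PerfectMatching G) λ N → IsHamCycleEdgeSet G (_∪E_ {G} Matched (PerfectMatching.M N))
    matching-on-cycle-extends = complement , complement-hamiltonian

module Untangle {V : Set} (_≟_ : DecidableEquality V) {m : ℕ} (C : CyclicOrder V m)
                (5≤1+m : 5 ≤ suc m) (p : V → V) (p-involutive : ∀ x → p (p x) ≡ x)
                (p-near : ∀ x → CyclicOrder.Near C x (p x)) where
  open CyclicOrder C renaming (next to S; prev to P; next-prev to S-P; prev-next to P-S)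

  private
    S≢ : ∀ x → S x ≢ x
    S≢ = iterate-next-≢ {1} (s≤s z≤n) (≤-trans (s≤s (s≤s z≤n)) 5≤1+m)
    S³≢ : ∀ x → S (S (S x)) ≢ x
    S³≢ = iterate-next-≢ {3} (s≤s z≤n) (≤-trans (n≤1+n 4) 5≤1+m)
    S⁴≢ : ∀ x → S (S (S (S x))) ≢ x
    S⁴≢ = iterate-next-≢ {4} (s≤s z≤n) 5≤1+m
    S-S-P-P : ∀ {y} → S (S (P (P y))) ≡ y
    S-S-P-P {y} = trans (cong S (S-P (P y))) (S-P y)

  p-swap : ∀ {x y} → p x ≡ y → p y ≡ x
  p-swap {x} refl = p-involutive x

  partner-cases : ∀ x → p x ≡ S x ⊎ p x ≡ P x ⊎ p x ≡ S (S x) ⊎ p x ≡ P (P x)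
  partner-cases x with p-near x
  ... | inj₁ e = inj₁ e
  ... | inj₂ (inj₁ e) = inj₂ (inj₁ (prev-unique (sym e)))
  ... | inj₂ (inj₂ (inj₁ e)) = inj₂ (inj₂ (inj₁ e))
  ... | inj₂ (inj₂ (inj₂ e)) = inj₂ (inj₂ (inj₂ (prev-unique (prev-unique (sym e)))))

  Crossing : V → Set
  Crossing y = p y ≡ S (S y) × p (P y) ≡ S y

  crossing? : ∀ y → Dec (Crossing y)
  crossing? y = (p y ≟ S (S y)) ×-dec (p (P y) ≟ S y)

  crossing-prev-next : ∀ {y} → Crossing y → Crossing (P (S y))
  crossing-prev-next {y} = subst Crossing (sym (P-S y))

  ¬crossing-next : ∀ {y} → Crossing y → ¬ Crossing (S y)
  ¬crossing-next {y} (_ , pPy≡Sy) (pSy≡S³y , _) = S⁴≢ (P y) (begin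
    S (S (S (S (P y)))) ≡⟨ cong (λ z → S (S (S z))) (S-P y) ⟩
    S (S (S y))         ≡⟨ pSy≡S³y ⟨
    p (S y)             ≡⟨ p-swap pPy≡Sy ⟩
    P y                   ∎)
    where open ≡-Reasoning

  ¬crossing-next² : ∀ {y} → Crossing y → ¬ Crossing (S (S y))
  ¬crossing-next² {y} (py≡S²y , _) (pS²y≡S⁴y , _) = S⁴≢ y (trans (sym pS²y≡S⁴y) (p-swap py≡S²y))

  ¬crossing-prev : ∀ {y} → Crossing y → ¬ Crossing (P y)
  ¬crossing-prev {y} c c' = ¬crossing-next c' (subst Crossing (sym (S-P y)) c)

  ¬crossing-prev² : ∀ {y} → Crossing y → ¬ Crossing (P (P y))
  ¬crossing-prev² {y} c c' =
    ¬crossing-next² c' (subst Crossing (sym S-S-P-P) c)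

  long-partner⇒crossing : ∀ {y} → p y ≡ S (S y) → Crossing y ⊎ Crossing (S y)
  long-partner⇒crossing {y} py≡S²y with partner-cases (S y)
  ... | inj₁ pSy≡S²y = ⊥-elim (S≢ y (trans (sym (p-swap pSy≡S²y)) (p-swap py≡S²y)))
  ... | inj₂ (inj₁ pSy≡PSy) =
    ⊥-elim (S≢ y (next-injective (trans (sym py≡S²y) (p-swap (trans pSy≡PSy (P-S y))))))
  ... | inj₂ (inj₂ (inj₁ pSy≡S³y)) = inj₂ (pSy≡S³y , trans (cong p (P-S y)) py≡S²y)
  ... | inj₂ (inj₂ (inj₂ pSy≡P²Sy)) = inj₁ (py≡S²y , p-swap (trans pSy≡P²Sy (cong P (P-S y))))

  -- τ swaps y and S y whenever Crossing y, so that in the conjugated cycle the crossing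
  -- matching edges {P y, S y} and {y, S (S y)} become consecutive cycle edges.
  τ : V → V
  τ y with crossing? y | crossing? (P y)
  ... | yes _ | _     = S y
  ... | no _  | yes _ = P y
  ... | no _  | no _  = y

  τ-crossing : ∀ {y} → Crossing y → τ y ≡ S y
  τ-crossing {y} c with crossing? y
  ... | yes _ = refl
  ... | no ¬c = ⊥-elim (¬c c)

  τ-crossing-prev : ∀ {y} → Crossing (P y) → τ y ≡ P y
  τ-crossing-prev {y} c with crossing? y | crossing? (P y)
  ... | yes c' | _     = ⊥-elim (¬crossing-prev c' c)
  ... | no _   | yes _ = refl
  ... | no _   | no ¬c = ⊥-elim (¬c c)

  τ-fixed : ∀ {y} → ¬ Crossing y → ¬ Crossing (P y) → τ y ≡ y
  τ-fixed {y} ¬c ¬c' with crossing? y | crossing? (P y)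
  ... | yes c | _     = ⊥-elim (¬c c)
  ... | no _  | yes c = ⊥-elim (¬c' c)
  ... | no _  | no _  = refl

  crossing-trichotomy : ∀ y → Crossing y ⊎ Crossing (P y) ⊎ (¬ Crossing y × ¬ Crossing (P y))
  crossing-trichotomy y with crossing? y | crossing? (P y)
  ... | yes c | _      = inj₁ c
  ... | no _  | yes c  = inj₂ (inj₁ c)
  ... | no ¬c | no ¬c' = inj₂ (inj₂ (¬c , ¬c'))

  τ-next-crossing : ∀ {y} → Crossing y → τ (S y) ≡ y
  τ-next-crossing {y} c = trans (τ-crossing-prev (crossing-prev-next c)) (P-S y)

  τ-fixed-next : ∀ {y} → ¬ Crossing y → ¬ Crossing (S y) → τ (S y) ≡ S y
  τ-fixed-next {y} ¬c ¬c' = τ-fixed ¬c' (¬c ∘ subst Crossing (P-S y))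

  τ-involutive : ∀ y → τ (τ y) ≡ y
  τ-involutive y with crossing-trichotomy y
  ... | inj₁ c = trans (cong τ (τ-crossing c)) (τ-next-crossing c)
  ... | inj₂ (inj₁ c) = trans (cong τ (τ-crossing-prev c)) (trans (τ-crossing c) (S-P y))
  ... | inj₂ (inj₂ (¬c , ¬c')) = trans (cong τ (τ-fixed ¬c ¬c')) (τ-fixed ¬c ¬c')

  τ-next-crossing-prev : ∀ {y} → Crossing (P y) → τ (S y) ≡ S y
  τ-next-crossing-prev {y} c = τ-fixed-next (λ c' → ¬crossing-prev c' c)
    (¬crossing-next² c ∘ subst Crossing (cong S (sym (S-P y))))

  partner-of-fixed : ∀ {y} → ¬ Crossing y → ¬ Crossing (P y) → p y ≡ τ (P y) ⊎ p y ≡ τ (S y)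
  partner-of-fixed {y} ¬c ¬c' with partner-cases y
  ... | inj₁ py≡Sy = inj₂ (trans py≡Sy (sym (τ-fixed-next ¬c ¬cSy)))
    where
    ¬cSy : ¬ Crossing (S y)
    ¬cSy (pSy≡S³y , _) = S³≢ y (trans (sym pSy≡S³y) (p-swap py≡Sy))
  ... | inj₂ (inj₁ py≡Py) = inj₁ (trans py≡Py (sym (τ-fixed ¬c' ¬cP²y)))
    where
    ¬cP²y : ¬ Crossing (P (P y))
    ¬cP²y (pP²y≡S²P²y , _) = S≢ y (trans (cong S y≡Py) (S-P y))
      where
      Py≡P²y : P y ≡ P (P y)
      Py≡P²y = trans (sym py≡Py) (p-swap (trans pP²y≡S²P²y S-S-P-P))
      y≡Py : y ≡ P y
      y≡Py = trans (sym (S-P y)) (trans (cong S Py≡P²y) (S-P (P y)))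
  ... | inj₂ (inj₂ (inj₁ py≡S²y)) with long-partner⇒crossing py≡S²y
  ...   | inj₁ c   = ⊥-elim (¬c c)
  ...   | inj₂ cSy = inj₂ (trans py≡S²y (sym (τ-crossing cSy)))
  partner-of-fixed {y} ¬c ¬c' | inj₂ (inj₂ (inj₂ py≡P²y))
    with long-partner⇒crossing (trans (p-swap py≡P²y) (sym S-S-P-P))
  ...   | inj₁ cP²y  = inj₁ (trans py≡P²y (sym (τ-crossing-prev cP²y)))
  ...   | inj₂ cSP²y = ⊥-elim (¬c' (subst Crossing (S-P (P y)) cSP²y))

  partner-of-τ : ∀ y → p (τ y) ≡ τ (P y) ⊎ p (τ y) ≡ τ (S y)
  partner-of-τ y with crossing-trichotomy y
  ... | inj₁ c@(_ , pPy≡Sy) = inj₁ (begin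
    p (τ y) ≡⟨ cong p (τ-crossing c) ⟩
    p (S y) ≡⟨ p-swap pPy≡Sy ⟩
    P y     ≡⟨ τ-fixed (¬crossing-prev c) (¬crossing-prev² c) ⟨
    τ (P y)       ∎)
    where open ≡-Reasoning
  ... | inj₂ (inj₁ c@(pPy≡S²Py , _)) = inj₂ (begin
    p (τ y)     ≡⟨ cong p (τ-crossing-prev c) ⟩
    p (P y)     ≡⟨ pPy≡S²Py ⟩
    S (S (P y)) ≡⟨ cong S (S-P y) ⟩
    S y         ≡⟨ τ-next-crossing-prev c ⟨
    τ (S y)       ∎)
    where open ≡-Reasoning
  ... | inj₂ (inj₂ (¬c , ¬c')) =
    subst (λ z → p z ≡ τ (P y) ⊎ p z ≡ τ (S y)) (sym (τ-fixed ¬c ¬c')) (partner-of-fixed ¬c ¬c')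

  τ-next-near : ∀ y → Near (τ y) (τ (S y))
  τ-next-near y with crossing-trichotomy y
  ... | inj₁ c = subst₂ Near (sym (τ-crossing c)) (sym (τ-next-crossing c)) (inj₂ (inj₁ refl))
  ... | inj₂ (inj₁ c) = subst₂ Near (sym (τ-crossing-prev c)) (sym (τ-next-crossing-prev c))
                          (inj₂ (inj₂ (inj₁ (cong S (sym (S-P y))))))
  ... | inj₂ (inj₂ (¬c , ¬c')) =
    subst (λ z → Near z (τ (S y))) (sym (τ-fixed ¬c ¬c')) (near-next (crossing? (S y)))
    where
    near-next : Dec (Crossing (S y)) → Near y (τ (S y))
    near-next (yes cSy) = subst (Near y) (sym (τ-crossing cSy)) (inj₂ (inj₂ (inj₁ refl)))
    near-next (no ¬cSy) = subst (Near y) (sym (τ-fixed-next ¬c ¬cSy)) (inj₁ refl)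

  untangled : CyclicOrder V m
  untangled = conjugate τ τ-involutive C

  open CyclicOrder untangled using () renaming (next to S′)

  untangled-near : ∀ x → Near x (S′ x)
  untangled-near x = subst (λ z → Near z (S′ x)) (τ-involutive x) (τ-next-near (τ x))

  untangled-partner-adjacent : ∀ x → p x ≡ S′ x ⊎ S′ (p x) ≡ x
  untangled-partner-adjacent x with partner-of-τ (τ x)
  ... | inj₁ e = inj₂ (begin
    τ (S (τ (p x)))         ≡⟨ cong (λ z → τ (S (τ z))) pe ⟩
    τ (S (τ (τ (P (τ x))))) ≡⟨ cong (λ z → τ (S z)) (τ-involutive (P (τ x))) ⟩
    τ (S (P (τ x)))         ≡⟨ cong τ (S-P (τ x)) ⟩
    τ (τ x)                 ≡⟨ τ-involutive x ⟩
    x                            ∎)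
    where
    open ≡-Reasoning
    pe : p x ≡ τ (P (τ x))
    pe = trans (cong p (sym (τ-involutive x))) e
  ... | inj₂ e = inj₁ (trans (cong p (sym (τ-involutive x))) e)

module Zigzag (m : ℕ) where
  private
    n : ℕ
    n = suc m

  zig : AccV n → AccV n
  zig (u i) = v (sucMod i)
  zig (v i) = u i

  position : AccV n → Fin (n * 2)
  position (v i) = combine i zero
  position (u i) = combine i (suc zero)

  vertex : Fin n → Fin 2 → AccV n
  vertex i zero       = v i
  vertex i (suc zero) = u i

  vertexAt : Fin (n * 2) → AccV n
  vertexAt = uncurry vertex ∘ remQuot 2

  vertexAt-position : ∀ x → vertexAt (position x) ≡ x
  vertexAt-position (v i) = cong (uncurry vertex) (remQuot-combine i zero)
  vertexAt-position (u i) = cong (uncurry vertex) (remQuot-combine i (suc zero))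

  position-vertexAt : ∀ a → position (vertexAt a) ≡ a
  position-vertexAt a = trans (position-vertex (remQuot {n} 2 a)) (combine-remQuot {n} 2 a)
    where
    position-vertex : ∀ ij → position (uncurry vertex ij) ≡ uncurry combine ij
    position-vertex (i , zero)     = refl
    position-vertex (i , suc zero) = refl

  position-zig : ∀ x → position (zig x) ≡ sucMod (position x)
  position-zig (v i) = toℕ-injective (begin
    toℕ (combine i (suc zero))           ≡⟨ toℕ-combine i (suc zero) ⟩
    2 * toℕ i + 1                        ≡⟨ m<n⇒m%n≡m 2i+1<2n ⟨
    (2 * toℕ i + 1) % (n * 2)            ≡⟨ cong (λ t → (t + 1) % (n * 2)) (+-identityʳ (2 * toℕ i)) ⟨
    (2 * toℕ i + 0 + 1) % (n * 2)        ≡⟨ cong (λ t → (t + 1) % (n * 2)) (toℕ-combine i zero) ⟨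
    (toℕ (combine i zero) + 1) % (n * 2) ≡⟨ toℕ-sucMod (combine i zero) ⟨
    toℕ (sucMod (combine i zero))               ∎)
    where
    open ≡-Reasoning
    2i+1<2n : 2 * toℕ i + 1 < n * 2
    2i+1<2n = subst₂ _≤_ (ar (toℕ i)) (*-comm 2 n) (*-monoʳ-≤ 2 (toℕ<n i))
      where
      ar : ∀ t → 2 * suc t ≡ suc (2 * t + 1)
      ar = solve-∀
  position-zig (u i) = toℕ-injective (begin
    toℕ (combine (sucMod i) zero)              ≡⟨ toℕ-combine (sucMod i) zero ⟩
    2 * toℕ (sucMod i) + 0                     ≡⟨ cong (λ t → 2 * t + 0) (toℕ-sucMod i) ⟩
    2 * ((toℕ i + 1) % n) + 0                  ≡⟨ trans (+-identityʳ _) (*-comm 2 ((toℕ i + 1) % n)) ⟩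
    (toℕ i + 1) % n * 2                        ≡⟨ m%n*o≡m*o%[n*o] (toℕ i + 1) n 2 ⟩
    (toℕ i + 1) * 2 % (n * 2)                  ≡⟨ cong (_% (n * 2)) (ar (toℕ i)) ⟩
    (2 * toℕ i + 1 + 1) % (n * 2)              ≡⟨ cong (λ t → (t + 1) % (n * 2)) (toℕ-combine i (suc zero)) ⟨
    (toℕ (combine i (suc zero)) + 1) % (n * 2) ≡⟨ toℕ-sucMod (combine i (suc zero)) ⟨
    toℕ (sucMod (combine i (suc zero)))         ∎)
    where
    open ≡-Reasoning
    ar : ∀ t → (t + 1) * 2 ≡ 2 * t + 1 + 1
    ar = solve-∀

  zigzag : CyclicOrder (AccV n) (suc (m * 2))
  zigzag = record
    { enumerate        = vertexAt
    ; index            = position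
    ; enumerate-index  = vertexAt-position
    ; index-enumerate  = position-vertexAt
    ; next             = zig
    ; enumerate-sucMod = λ a → begin
        vertexAt (sucMod a)                        ≡⟨ cong (vertexAt ∘ sucMod) (position-vertexAt a) ⟨
        vertexAt (sucMod (position (vertexAt a)))  ≡⟨ cong vertexAt (position-zig (vertexAt a)) ⟨
        vertexAt (position (zig (vertexAt a)))     ≡⟨ vertexAt-position (zig (vertexAt a)) ⟩
        zig (vertexAt a)                           ∎
    }
    where open ≡-Reasoning

  open CyclicOrder zigzag using (Near)

  private
    E : AccV n → AccV n → Set
    E = AccE n 1

  AccE-sym : ∀ x y → E x y → E y x
  AccE-sym (u i) (u j) = Sum.swap
  AccE-sym (v i) (v j) = Sum.swap
  AccE-sym (u i) (v j) e = e
  AccE-sym (v i) (u j) e = e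

  shift-1⇒sucMod : ∀ {i j : Fin n} → (toℕ i + 1) % n ≡ toℕ j → j ≡ sucMod i
  shift-1⇒sucMod {i} e = toℕ-injective (trans (sym e) (sym (toℕ-sucMod i)))

  zig-edge : ∀ x → E x (zig x)
  zig-edge (u i) = inj₂ (sym (toℕ-sucMod i))
  zig-edge (v i) = inj₁ refl

  zig²-edge : ∀ x → E x (zig (zig x))
  zig²-edge (u i) = inj₁ (sym (toℕ-sucMod i))
  zig²-edge (v i) = inj₁ (sym (toℕ-sucMod i))

  near⇒edge : ∀ {x y} → Near x y → E x y
  near⇒edge {x}     (inj₁ refl)                = zig-edge x
  near⇒edge {y = y} (inj₂ (inj₁ refl))         = AccE-sym y (zig y) (zig-edge y)
  near⇒edge {x}     (inj₂ (inj₂ (inj₁ refl)))  = zig²-edge x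
  near⇒edge {y = y} (inj₂ (inj₂ (inj₂ refl)))  = AccE-sym y (zig (zig y)) (zig²-edge y)

  edge⇒near : ∀ x y → E x y → Near x y
  edge⇒near (u i) (u j) (inj₁ s) = inj₂ (inj₂ (inj₁ (cong u (shift-1⇒sucMod {i} s))))
  edge⇒near (u i) (u j) (inj₂ s) = inj₂ (inj₂ (inj₂ (cong u (shift-1⇒sucMod {j} s))))
  edge⇒near (v i) (v j) (inj₁ s) = inj₂ (inj₂ (inj₁ (cong v (shift-1⇒sucMod {i} s))))
  edge⇒near (v i) (v j) (inj₂ s) = inj₂ (inj₂ (inj₂ (cong v (shift-1⇒sucMod {j} s))))
  edge⇒near (u i) (v j) (inj₁ refl) = inj₂ (inj₁ refl)
  edge⇒near (u i) (v j) (inj₂ s)    = inj₁ (cong v (shift-1⇒sucMod {i} s))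
  edge⇒near (v j) (u i) (inj₁ refl) = inj₁ refl
  edge⇒near (v j) (u i) (inj₂ s)    = inj₂ (inj₁ (cong v (shift-1⇒sucMod {i} s)))

_≟V_ : ∀ {n} → DecidableEquality (AccV n)
u i ≟V u j with i Fin.≟ j
... | yes refl = yes refl
... | no i≢j   = no λ { refl → i≢j refl }
v i ≟V v j with i Fin.≟ j
... | yes refl = yes refl
... | no i≢j   = no λ { refl → i≢j refl }
u i ≟V v j = no λ ()
v i ≟V u j = no λ ()

antiprism-PMH : ∀ k → PMH (Accordion (3 + k) 1)
antiprism-PMH k matching =
  matching-on-cycle-extends (Accordion (3 + k) 1) untangled matching
    (s≤s (s≤s (s≤s z≤n))) untangled-edge untangled-edge⁻ untangled-partner-adjacent
  where
  open Zigzag (2 + k)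
  open PerfectMatching matching using (partner; M-edges; M-cover)
  open Untangle _≟V_ zigzag (s≤s (s≤s (s≤s (s≤s (s≤s z≤n))))) partner (partner-involutive matching)
                (λ x → edge⇒near x (partner x) (M-edges x (partner x) (M-cover x)))
  open CyclicOrder untangled using (next)

  untangled-edge : ∀ x → AccE (3 + k) 1 x (next x)
  untangled-edge x = near⇒edge (untangled-near x)

  untangled-edge⁻ : ∀ x → AccE (3 + k) 1 (next x) x
  untangled-edge⁻ x = AccE-sym x (next x) (untangled-edge x)

theorem3p2 : (n : ℕ) .{{_ : NonZero n}} → 3 ≤ n → PMH (Accordion n 1)
theorem3p2 (suc (suc (suc k))) _ = antiprism-PMH k
theorem3p2 (suc zero)       (s≤s ())
theorem3p2 (suc (suc zero)) (s≤s (s≤s ()))
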